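{- Let $G$ be a nontrivial connected graph of order $n$ and diameter $d$, and let $k$ be an integer with $1\leq k\leq d$. Then $SSPC_{kU}(G)\leq n-k+1$.
   Context: All graphs are finite and simple; $d(u,v)$ is the distance. A set $S\subseteq V(G)$ is a $k$-strong shortest path union cover of $G$ if one can choose, for each $u\in S$ and each $v\in V(G)$ with $d(u,v)\leq k$, a single shortest $u$–$v$ path $P(u,v)$ such that the union of the edge sets of all chosen paths equals $E(G)$; $SSPC_{kU}(G)$ is the minimum cardinality of such a set. -}

module Defs where

open import Data.Nat using (ℕ; zero; suc; _≤_; _∸_; _+_)
open import Data.Fin using (Fin)
open import Data.Fin.Subset using (Subset; _∈_; ∣_∣)
open import Data.List using (List; []; _∷_)
open import Data.Product using (Σ; ∃; _×_; _,_)
open import Data.Sum using (_⊎_)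
open import Relation.Nullary using (¬_; Dec)
open import Relation.Binary.PropositionalEquality using (_≡_)

record Graph (n : ℕ) : Set₁ where
  field
    Adj      : Fin n → Fin n → Set
    adj?     : ∀ x y → Dec (Adj x y)
    adj-sym  : ∀ {x y} → Adj x y → Adj y x
    adj-irr  : ∀ x → ¬ Adj x x
open Graph public

module _ {n : ℕ} (G : Graph n) where

  data Walk : Fin n → Fin n → ℕ → List (Fin n) → Set where
    wnil  : ∀ u → Walk u u 0 (u ∷ [])
    wcons : ∀ {u w v l xs} → Adj G u w → Walk w v l xs → Walk u v (suc l) (u ∷ xs)

  Dist : Fin n → Fin n → ℕ → Set
  Dist u v l = (∃ λ xs → Walk u v l xs) × (∀ m xs → Walk u v m xs → l ≤ m)

  Connected : Set
  Connected = ∀ u v → ∃ λ l → ∃ λ xs → Walk u v l xs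

  Diameter : ℕ → Set
  Diameter d = (∃ λ u → ∃ λ v → Dist u v d) × (∀ u v l → Dist u v l → l ≤ d)

data Consec {n : ℕ} (x y : Fin n) : List (Fin n) → Set where
  here  : ∀ {xs} → Consec x y (x ∷ y ∷ xs)
  there : ∀ {z xs} → Consec x y xs → Consec x y (z ∷ xs)

EdgeOn : ∀ {n} → Fin n → Fin n → List (Fin n) → Set
EdgeOn x y xs = Consec x y xs ⊎ Consec y x xs

-- S is a k-strong shortest path union cover of G:
-- P u v is the chosen shortest u–v path for u ∈ S, d(u,v) ≤ k, and the union of
-- the edge sets of these chosen paths is E(G).
IsSSPCkU : ∀ {n} → Graph n → ℕ → Subset n → Set
IsSSPCkU {n} G k S =
  Σ (Fin n → Fin n → List (Fin n)) λ P →
    (∀ u v l → u ∈ S → Dist G u v l → l ≤ k → Walk G u v l (P u v))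
    × (∀ x y → Adj G x y →
         ∃ λ u → ∃ λ v → ∃ λ l →
           u ∈ S × Dist G u v l × l ≤ k × EdgeOn x y (P u v))

SSPCkU≤ : ∀ {n} → Graph n → ℕ → ℕ → Set
SSPCkU≤ {n} G k m = Σ (Subset n) λ S → IsSSPCkU G k S × ∣ S ∣ ≤ m

{-# OPTIONS --safe #-}
-- Let u₀ = w₀, w₁, …, w_d be a shortest walk realising the diameter and S the
-- vertex set without w₁, …, w_{k-1}, so ∣S∣ = n - k + 1.  A shortest walk has no
-- chords, so an edge with both ends off S is some w_i w_{i+1} with i < k, and is
-- covered by choosing the prefix of the walk as the path from u₀ ∈ S to w_{i+1}.
-- Every other edge has an end u ∈ S and is covered by itself as a path from u.
module Submission where

open import Defs
open import Data.Nat using (ℕ; zero; suc; _+_; _∸_; _≤_; _<_; z≤n; s≤s; s≤s⁻¹)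
open import Data.Nat.Properties
open import Data.Fin using (Fin) renaming (_≟_ to _≟ᶠ_)
open import Data.Fin.Properties using (any?)
open import Data.Fin.Subset using (Subset; ⊤; _-_; ∣_∣; _∈_; _∉_)
open import Data.Fin.Subset.Properties using (∈⊤; ∣⊤∣≡n; _∈?_; x∈p∧x≢y⇒x∈p-y; x∈p⇒∣p-x∣<∣p∣)
open import Data.List using (List; take)
open import Data.Product using (∃; _×_; _,_; proj₁; proj₂)
open import Data.Sum using (_⊎_; inj₁; inj₂; [_,_]′; swap)
open import Function using (_∘_)
open import Relation.Nullary using (¬_; Dec; yes; no; contradiction)
open import Relation.Nullary.Decidable using (_×-dec_)
open import Relation.Binary.PropositionalEquality using (_≡_; _≢_; refl; sym; trans; cong; subst; subst₂)
open import Relation.Binary.Definitions using (tri<; tri≈; tri>)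

module _ {p} {P : ℕ → Set p} (P? : ∀ m → Dec (P m)) where

  Least : ℕ → Set p
  Least m = P m × (∀ m′ → P m′ → m ≤ m′)

  private
    leastBelow : ∀ b → ∃ Least ⊎ (∀ m → m < b → ¬ P m)
    leastBelow zero = inj₂ λ _ ()
    leastBelow (suc b) with leastBelow b
    ... | inj₁ least = inj₁ least
    ... | inj₂ none with P? b
    ...   | yes pb = inj₁ (b , pb , λ m′ pm′ → ≮⇒≥ λ m′<b → none m′ m′<b pm′)
    ...   | no ¬pb = inj₂ λ m m<1+b → [ none m , (λ { refl → ¬pb }) ]′ (m≤n⇒m<n∨m≡n (s≤s⁻¹ m<1+b))

  least-witness : ∀ {b} → P b → ∃ Least
  least-witness {b} pb with leastBelow (suc b)
  ... | inj₁ least = least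
  ... | inj₂ none  = contradiction pb (none b ≤-refl)

m∸n≤m∸[1+n]+1 : ∀ m n → m ∸ n ≤ m ∸ suc n + 1
m∸n≤m∸[1+n]+1 zero    zero    = z≤n
m∸n≤m∸[1+n]+1 zero    (suc n) = z≤n
m∸n≤m∸[1+n]+1 (suc m) zero    = ≤-reflexive (+-comm 1 m)
m∸n≤m∸[1+n]+1 (suc m) (suc n) = m∸n≤m∸[1+n]+1 m n

module _ {n : ℕ} (G : Graph n) where

  walk? : ∀ l u v → Dec (∃ (Walk G u v l))
  walk? zero u v with u ≟ᶠ v
  ... | yes refl = yes (_ , wnil u)
  ... | no u≢v   = no λ { (_ , wnil _) → u≢v refl }
  walk? (suc l) u v with any? (λ w → adj? G u w ×-dec walk? l w v)
  ... | yes (_ , uw , _ , walk) = yes (_ , wcons uw walk)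
  ... | no none = no λ { (_ , wcons {w = w} uw walk) → none (w , uw , _ , walk) }

  dist-exists : Connected G → ∀ u v → ∃ (Dist G u v)
  dist-exists connected u v with least-witness (λ l → walk? l u v) (proj₂ (connected u v))
  ... | l , walk , minimal = l , walk , λ m xs w → minimal m (xs , w)

  dist-unique : ∀ {u v l l′} → Dist G u v l → Dist G u v l′ → l ≡ l′
  dist-unique ((_ , w) , minimal) ((_ , w′) , minimal′) = ≤-antisym (minimal _ _ w′) (minimal′ _ _ w)

  adj⇒dist1 : ∀ {x y} → Adj G x y → Dist G x y 1
  adj⇒dist1 {x} {y} xy = (_ , wcons xy (wnil y)) , positive
    where
    positive : ∀ m xs → Walk G x y m xs → 1 ≤ m
    positive _ _ (wnil _)    = contradiction xy (adj-irr G x)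
    positive _ _ (wcons _ _) = s≤s z≤n

  walk1⇒consec : ∀ {x y xs} → Walk G x y 1 xs → Consec x y xs
  walk1⇒consec (wcons _ (wnil _)) = here

  vertexAt : ∀ {u v l xs} → Walk G u v l xs → ℕ → Fin n
  vertexAt (wnil u)            _       = u
  vertexAt (wcons {u = u} _ _) zero    = u
  vertexAt (wcons _ walk)      (suc i) = vertexAt walk i

  vertexAt-zero : ∀ {u v l xs} (walk : Walk G u v l xs) → vertexAt walk 0 ≡ u
  vertexAt-zero (wnil _)    = refl
  vertexAt-zero (wcons _ _) = refl

  prefix : ∀ {u v l xs} (walk : Walk G u v l xs) i → i ≤ l → Walk G u (vertexAt walk i) i (take (suc i) xs)
  prefix (wnil u)       zero    _         = wnil u
  prefix (wcons _ _)    zero    _         = wnil _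
  prefix (wcons e walk) (suc i) (s≤s i≤l) = wcons e (prefix walk i i≤l)

  suffix : ∀ {u v l xs} (walk : Walk G u v l xs) i → i ≤ l → ∃ (Walk G (vertexAt walk i) v (l ∸ i))
  suffix (wnil u)       zero    _         = _ , wnil u
  suffix (wcons e walk) zero    _         = _ , wcons e walk
  suffix (wcons _ walk) (suc i) (s≤s i≤l) = suffix walk i i≤l

  _++ʷ_ : ∀ {a b c p q ys zs} → Walk G a b p ys → Walk G b c q zs → ∃ (Walk G a c (p + q))
  wnil _       ++ʷ walk′ = _ , walk′
  wcons e walk ++ʷ walk′ = _ , wcons e (proj₂ (walk ++ʷ walk′))

  consec-prefix : ∀ {u v l xs} (walk : Walk G u v l xs) i → suc i ≤ l →
                  Consec (vertexAt walk i) (vertexAt walk (suc i)) (take (suc (suc i)) xs)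
  consec-prefix (wcons _ (wnil _))    zero    _         = here
  consec-prefix (wcons _ (wcons _ _)) zero    _         = here
  consec-prefix (wcons _ walk)        (suc i) (s≤s i<l) = there (consec-prefix walk i i<l)

  module ShortestWalk {u₀ v₀ d xs₀} (W : Walk G u₀ v₀ d xs₀)
                      (W-shortest : ∀ m ys → Walk G u₀ v₀ m ys → d ≤ m) where

    w : ℕ → Fin n
    w = vertexAt W

    walk-to-w-length : ∀ {j m ys} → j ≤ d → Walk G u₀ (w j) m ys → j ≤ m
    walk-to-w-length {j} {m} j≤d walk = +-cancelʳ-≤ (d ∸ j) j m (begin
      j + (d ∸ j) ≡⟨ m+[n∸m]≡n j≤d ⟩
      d           ≤⟨ W-shortest _ _ (proj₂ (walk ++ʷ proj₂ (suffix W j j≤d))) ⟩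
      m + (d ∸ j) ∎)
      where open ≤-Reasoning

    dist-w : ∀ i → i ≤ d → Dist G u₀ (w i) i
    dist-w i i≤d = (_ , prefix W i i≤d) , λ _ _ → walk-to-w-length i≤d

    w-injective : ∀ {i j} → i < j → j ≤ d → w i ≢ w j
    w-injective {i} i<j j≤d wi≡wj =
      <⇒≱ i<j (walk-to-w-length j≤d (subst (λ x → Walk G u₀ x i _) wi≡wj (prefix W i (≤-trans (<⇒≤ i<j) j≤d))))

    no-chord : ∀ {i j} → suc i < j → j ≤ d → ¬ Adj G (w i) (w j)
    no-chord {i} {j} 1+i<j j≤d chord = <⇒≱ 1+i<j (begin
      j     ≤⟨ walk-to-w-length j≤d (proj₂ (prefix W i i≤d ++ʷ wcons chord (wnil _))) ⟩
      i + 1 ≡⟨ +-comm i 1 ⟩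
      suc i ∎)
      where
      open ≤-Reasoning
      i≤d = ≤-trans (≤-trans (n≤1+n i) (<⇒≤ 1+i<j)) j≤d

    adjacent-on-W : ∀ {i j} → i ≤ d → j ≤ d → Adj G (w i) (w j) → j ≡ suc i ⊎ i ≡ suc j
    adjacent-on-W {i} {j} i≤d j≤d wiwj with <-cmp i j
    ... | tri≈ _ refl _ = contradiction wiwj (adj-irr G (w i))
    ... | tri< i<j _ _ with m≤n⇒m<n∨m≡n i<j
    ...   | inj₁ 1+i<j = contradiction wiwj (no-chord 1+i<j j≤d)
    ...   | inj₂ 1+i≡j = inj₁ (sym 1+i≡j)
    adjacent-on-W {i} {j} i≤d j≤d wiwj | tri> _ _ j<i with m≤n⇒m<n∨m≡n j<i
    ...   | inj₁ 1+j<i = contradiction (adj-sym G wiwj) (no-chord 1+j<i i≤d)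
    ...   | inj₂ 1+j≡i = inj₂ (sym 1+j≡i)

    avoiding : ℕ → Subset n
    avoiding zero    = ⊤
    avoiding (suc j) = avoiding j - w (suc j)

    ∈avoiding : ∀ {j v} → (∀ m → 1 ≤ m → m ≤ j → w m ≢ v) → v ∈ avoiding j
    ∈avoiding {zero}  _   = ∈⊤
    ∈avoiding {suc j} off = x∈p∧x≢y⇒x∈p-y (∈avoiding λ m 1≤m m≤j → off m 1≤m (m≤n⇒m≤1+n m≤j))
                                          (off (suc j) (s≤s z≤n) ≤-refl ∘ sym)

    ∉avoiding : ∀ {j v} → v ∉ avoiding j → ∃ λ m → 1 ≤ m × m ≤ j × w m ≡ v
    ∉avoiding {zero}  v∉ = contradiction ∈⊤ v∉
    ∉avoiding {suc j} {v} v∉ with w (suc j) ≟ᶠ v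
    ... | yes on = suc j , s≤s z≤n , ≤-refl , on
    ... | no off with ∉avoiding (v∉ ∘ λ v∈ → x∈p∧x≢y⇒x∈p-y v∈ (off ∘ sym))
    ...   | m , 1≤m , m≤j , on = m , 1≤m , m≤n⇒m≤1+n m≤j , on

    ∣avoiding∣+j≤n : ∀ j → j ≤ d → ∣ avoiding j ∣ + j ≤ n
    ∣avoiding∣+j≤n zero    _ = ≤-reflexive (trans (+-identityʳ _) (∣⊤∣≡n n))
    ∣avoiding∣+j≤n (suc j) 1+j≤d = begin
      ∣ avoiding j - w (suc j) ∣ + suc j ≡⟨ +-suc _ j ⟩
      suc ∣ avoiding j - w (suc j) ∣ + j ≤⟨ +-monoˡ-≤ j (x∈p⇒∣p-x∣<∣p∣ w[1+j]∈) ⟩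
      ∣ avoiding j ∣ + j                 ≤⟨ ∣avoiding∣+j≤n j (≤-trans (n≤1+n j) 1+j≤d) ⟩
      n                                  ∎
      where
      open ≤-Reasoning
      w[1+j]∈ = ∈avoiding λ m _ m≤j → w-injective (s≤s m≤j) 1+j≤d

    module _ (connected : Connected G) where

      δ : Fin n → Fin n → ℕ
      δ u v = proj₁ (dist-exists connected u v)

      geodesic : Fin n → Fin n → List (Fin n)
      geodesic u v = proj₁ (proj₁ (proj₂ (dist-exists connected u v)))

      geodesic-walk : ∀ {u v l} → Dist G u v l → Walk G u v l (geodesic u v)
      geodesic-walk {u} {v} D = subst (λ m → Walk G u v m (geodesic u v)) (dist-unique D′ D) (proj₂ (proj₁ D′))
        where D′ = proj₂ (dist-exists connected u v)

      -- From u₀, a vertex of W is reached along W: its distance from u₀ is its index.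
      route : Fin n → Fin n → List (Fin n)
      route u v with u ≟ᶠ u₀ | w (δ u v) ≟ᶠ v
      ... | yes _ | yes _ = take (suc (δ u v)) xs₀
      ... | _     | _     = geodesic u v

      route-walk : ∀ {u v l} → Dist G u v l → l ≤ d → Walk G u v l (route u v)
      route-walk {u} {v} {l} D l≤d with u ≟ᶠ u₀ | w (δ u v) ≟ᶠ v
      ... | yes refl | yes on = subst₂ (λ i x → Walk G u₀ x l (take (suc i) xs₀))
                                       (sym δ≡l) (trans (cong w (sym δ≡l)) on) (prefix W l l≤d)
        where δ≡l = dist-unique (proj₂ (dist-exists connected u₀ v)) D
      ... | yes _    | no _   = geodesic-walk D
      ... | no _     | _      = geodesic-walk D

      δ-w : ∀ i → i ≤ d → δ u₀ (w i) ≡ i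
      δ-w i i≤d = dist-unique (proj₂ (dist-exists connected u₀ (w i))) (dist-w i i≤d)

      route-along-W : ∀ i → i ≤ d → route u₀ (w i) ≡ take (suc i) xs₀
      route-along-W i i≤d with u₀ ≟ᶠ u₀ | w (δ u₀ (w i)) ≟ᶠ w i
      ... | yes _    | yes _  = cong (λ m → take (suc m) xs₀) (δ-w i i≤d)
      ... | yes _    | no off = contradiction (cong w (δ-w i i≤d)) off
      ... | no u₀≢u₀ | _      = contradiction refl u₀≢u₀

      module _ {K} (1+K≤d : suc K ≤ d) where

        Covered : Fin n → Fin n → Set
        Covered x y = ∃ λ u → ∃ λ v → ∃ λ l →
                        u ∈ avoiding K × Dist G u v l × l ≤ suc K × EdgeOn x y (route u v)

        covered-sym : ∀ {x y} → Covered x y → Covered y x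
        covered-sym (u , v , l , u∈ , D , l≤k , on) = u , v , l , u∈ , D , l≤k , swap on

        covered-from : ∀ {x y} → x ∈ avoiding K → Adj G x y → Covered x y
        covered-from {x} {y} x∈ xy =
          x , y , 1 , x∈ , adj⇒dist1 xy , s≤s z≤n ,
          inj₁ (walk1⇒consec (route-walk (adj⇒dist1 xy) (≤-trans (s≤s z≤n) 1+K≤d)))

        ≤K⇒≤d : ∀ {i} → i ≤ K → i ≤ d
        ≤K⇒≤d i≤K = ≤-trans i≤K (≤-trans (n≤1+n K) 1+K≤d)

        u₀∈avoiding : u₀ ∈ avoiding K
        u₀∈avoiding = ∈avoiding λ m 1≤m m≤K wm≡u₀ →
          w-injective 1≤m (≤K⇒≤d m≤K) (trans (vertexAt-zero W) (sym wm≡u₀))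

        covered-along-W : ∀ i → i ≤ K → Covered (w i) (w (suc i))
        covered-along-W i i≤K =
          u₀ , w (suc i) , suc i , u₀∈avoiding , dist-w (suc i) 1+i≤d , s≤s i≤K ,
          inj₁ (subst (Consec _ _) (sym (route-along-W (suc i) 1+i≤d)) (consec-prefix W i 1+i≤d))
          where 1+i≤d = ≤-trans (s≤s i≤K) 1+K≤d

        covered : ∀ x y → Adj G x y → Covered x y
        covered x y xy with x ∈? avoiding K | y ∈? avoiding K
        ... | yes x∈ | _      = covered-from x∈ xy
        ... | no _   | yes y∈ = covered-sym (covered-from y∈ (adj-sym G xy))
        ... | no x∉  | no y∉ with ∉avoiding x∉ | ∉avoiding y∉
        ...   | i , _ , i≤K , refl | j , _ , j≤K , refl with adjacent-on-W (≤K⇒≤d i≤K) (≤K⇒≤d j≤K) xy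
        ...     | inj₁ refl = covered-along-W i i≤K
        ...     | inj₂ refl = covered-sym (covered-along-W j j≤K)

        SSPCkU≤-avoiding : SSPCkU≤ G (suc K) (n ∸ K)
        SSPCkU≤-avoiding =
          avoiding K ,
          (route , (λ _ _ _ _ D l≤k → route-walk D (≤-trans l≤k 1+K≤d)) , covered) ,
          m+n≤o⇒m≤o∸n _ (∣avoiding∣+j≤n K (≤K⇒≤d ≤-refl))

mainTheorem5 : ∀ (n : ℕ) (G : Graph n) (d k : ℕ) →
                 2 ≤ n → Connected G → Diameter G d →
                 1 ≤ k → k ≤ d →
                 SSPCkU≤ G k (n ∸ k + 1)
mainTheorem5 n G d (suc K) _ connected ((_ , _ , (_ , W) , W-shortest) , _) (s≤s z≤n) k≤d
  with ShortestWalk.SSPCkU≤-avoiding G W W-shortest connected k≤d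
... | S , cover , ∣S∣≤n∸K = S , cover , ≤-trans ∣S∣≤n∸K (m∸n≤m∸[1+n]+1 n K)
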